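{- Let $M\in\mathbb{R}^{n\times d}$ and $S\in\mathbb{B}^{n\times d}$. Then $S$ is satisfiable with respect to $M$ if and only if every partial bijection contained in $S$ is permanent-attaining with respect to $M$.
   Context: $\mathbb{B}^{n\times d}$ is the set of $n\times d$ Boolean matrices with entrywise order $\preceq$. For $a,y\in\mathbb{R}^n$, $\mathrm{Dom}_i(a)=\{y: y_i-a_i=\min_k(y_k-a_k)\}$. A point $x\in\mathbb{R}^n$ satisfies $S$ (with respect to $M$, with columns $M_{\star j}$) if $x\in\mathrm{Dom}_i(M_{\star j})$ for all $(i,j)$ with $S_{ij}=1$; $S$ is satisfiable if some point satisfies it. A partial bijection $\sigma:[d]\dashrightarrow[n]$ is a bijection $\sigma:J\to I$ with $J\subseteq[d]$, $I\subseteq[n]$, identified with $\Sigma\in\mathbb{B}^{n\times d}$, $\Sigma_{ij}=1$ iff $j\in J$ and $i=\sigma(j)$; $S$ contains $\sigma$ if $\Sigma\preceq S$. $\sigma$ is permanent-attaining with respect to $M$ if $\sum_{j\in J}M_{\sigma(j),j}\ge\sum_{j\in J}M_{\tau(j),j}$ for every bijection $\tau:J\to I$. -}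

module Defs where

open import Level using (Level; _⊔_) renaming (suc to lsuc)
open import Algebra.Bundles using (CommutativeRing)
open import Relation.Binary.Core using (Rel)
open import Relation.Binary.Structures using (IsTotalOrder)
open import Relation.Binary.PropositionalEquality using (_≡_)
open import Relation.Nullary using (¬_; does)
open import Data.Bool using (Bool; true; false)
import Data.Bool as B
open import Data.Fin using (Fin; zero; suc)
import Data.Fin as F
open import Data.Nat using (ℕ)
open import Data.Maybe using (Maybe; just; nothing; maybe)
open import Data.Product using (Σ; ∃; _×_; _,_)
open import Function.Bundles using (_⇔_)

-- Ordered fields (the reals are one; the stdlib has no ℝ).

record OrderedField (c ℓ₁ ℓ₂ : Level) : Set (lsuc (c ⊔ ℓ₁ ⊔ ℓ₂)) where
  field
    commutativeRing : CommutativeRing c ℓ₁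
  open CommutativeRing commutativeRing public
  field
    _≤_          : Rel Carrier ℓ₂
    isTotalOrder : IsTotalOrder _≈_ _≤_
    +-mono-≤     : ∀ {x y} z → x ≤ y → (x + z) ≤ (y + z)
    *-nonneg     : ∀ {x y} → 0# ≤ x → 0# ≤ y → 0# ≤ (x * y)
    1≉0          : ¬ (1# ≈ 0#)
    inverse      : ∀ x → ¬ (x ≈ 0#) → ∃ λ y → (x * y) ≈ 1#

module _ {c ℓ₁ ℓ₂} (R : OrderedField c ℓ₁ ℓ₂) where
  open OrderedField R

  Mat : ℕ → ℕ → Set c
  Mat n d = Fin n → Fin d → Carrier

  Vect : ℕ → Set c
  Vect n = Fin n → Carrier

  _-ᶠ_ : Carrier → Carrier → Carrier
  x -ᶠ y = x + (- y)

  Dom : ∀ {n} → Fin n → Vect n → Vect n → Set ℓ₂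
  Dom {n} i a y = ∀ (k : Fin n) → (y i -ᶠ a i) ≤ (y k -ᶠ a k)

  col : ∀ {n d} → Mat n d → Fin d → Vect n
  col M j i = M i j

  sumFin : ∀ {d} → (Fin d → Carrier) → Carrier
  sumFin {ℕ.zero}  f = 0#
  sumFin {ℕ.suc d} f = f F.zero + sumFin (λ j → f (F.suc j))

BMat : ℕ → ℕ → Set
BMat n d = Fin n → Fin d → Bool

_⪯_ : ∀ {n d} → BMat n d → BMat n d → Set
A ⪯ B = ∀ i j → A i j B.≤ B i j

-- Partial maps [d] ⇀ [n] : J = domain, image = I.

PMap : ℕ → ℕ → Set
PMap d n = Fin d → Maybe (Fin n)

InDom : ∀ {d n} → PMap d n → Fin d → Set
InDom σ j = ∃ λ i → σ j ≡ just i

InImg : ∀ {d n} → PMap d n → Fin n → Set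
InImg σ i = ∃ λ j → σ j ≡ just i

IsPartialBijection : ∀ {d n} → PMap d n → Set
IsPartialBijection σ = ∀ j j' i → σ j ≡ just i → σ j' ≡ just i → j ≡ j'

IsBijectionOnto : ∀ {d n} → PMap d n → PMap d n → Set
IsBijectionOnto σ τ =
  IsPartialBijection τ
  × (∀ j → InDom τ j ⇔ InDom σ j)
  × (∀ i → InImg τ i ⇔ InImg σ i)

toBMat : ∀ {d n} → PMap d n → BMat n d
toBMat σ i j = maybe (λ i' → does (i' F.≟ i)) false (σ j)

Contains : ∀ {n d} → BMat n d → PMap d n → Set
Contains S σ = toBMat σ ⪯ S

module _ {c ℓ₁ ℓ₂} (R : OrderedField c ℓ₁ ℓ₂) where
  open OrderedField R

  pmSum : ∀ {n d} → Mat R n d → PMap d n → Carrier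
  pmSum M τ = sumFin R (λ j → maybe (λ i → M i j) 0# (τ j))

  Satisfies : ∀ {n d} → Mat R n d → BMat n d → Vect R n → Set ℓ₂
  Satisfies {n} {d} M S x =
    ∀ (i : Fin n) (j : Fin d) → S i j ≡ true → Dom R i (col R M j) x

  Satisfiable : ∀ {n d} → Mat R n d → BMat n d → Set (c ⊔ ℓ₂)
  Satisfiable {n} M S = ∃ λ (x : Vect R n) → Satisfies M S x

  PermanentAttaining : ∀ {n d} → Mat R n d → PMap d n → Set ℓ₂
  PermanentAttaining M σ =
    ∀ τ → IsBijectionOnto σ τ → pmSum M τ ≤ pmSum M σ

module Submission where

-- A point x satisfies S exactly when x i − x k ≤ M i j − M k j for all k and all (i, j) with
-- S i j = 1: a system of difference constraints, i.e. a weighted graph on the rows with an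
-- edge i →ⱼ k of weight M i j − M k j. Such a system is solvable iff the graph has no negative
-- cycle (Fourier–Motzkin elimination of one row at a time). Every cycle splits into cycles in
-- which no column, source row or target row repeats; such a simple cycle is a pair of partial
-- bijections σ ⊆ S and τ with the same domain and image, and its weight is Σ M σ − Σ M τ,
-- which is nonnegative when σ is permanent-attaining. Conversely, summing the defining
-- inequalities of a satisfying point along σ and τ shows that σ is permanent-attaining.

open import Defs
open import Level using (_⊔_)
open import Data.Bool using (true; if_then_else_)
import Data.Bool as Bool
import Data.Bool.Properties as BoolP
open import Data.Empty using (⊥-elim)
open import Data.Fin using (Fin; zero; suc; _≟_)
import Data.Fin.Properties as FinP
open import Data.List using (List; []; _∷_; _++_; map; mapMaybe; allFin; cartesianProduct; cartesianProductWith)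
import Data.List.Membership.DecPropositional as DecMembership
open import Data.List.Membership.Propositional using (_∈_; _∉_)
open import Data.List.Membership.Propositional.Properties
  using (∈-map⁺; ∈-map⁻; ∈-++⁺ˡ; ∈-++⁺ʳ; ∈-++⁻; ∈-allFin; ∈-cartesianProduct⁺;
         ∈-cartesianProductWith⁺; ∈-cartesianProductWith⁻)
import Data.List.Relation.Unary.All as All
open import Data.List.Relation.Unary.All.Properties using (All¬⇒¬Any; ¬Any⇒All¬)
open import Data.List.Relation.Unary.Any using (here; there)
open import Data.List.Relation.Unary.Unique.Propositional using (Unique; []; _∷_)
open import Data.Maybe using (Maybe; just; nothing; maybe)
import Data.Maybe.Properties as MaybeP
open import Data.Nat using (ℕ)
import Data.Nat as Nat
open import Data.Nat.Induction using (<-wellFounded)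
import Data.Nat.Properties as NatP
open import Data.Product using (∃; ∃₂; _×_; _,_; proj₁; proj₂)
import Data.Product as Product
open import Data.Sum using (_⊎_; inj₁; inj₂)
open import Function.Base using (_∘_)
open import Function.Bundles using (_⇔_; mk⇔; Equivalence)
open import Function.Properties.Equivalence using (⇔-isEquivalence)
open import Induction.WellFounded using (Acc; acc)
open import Relation.Binary.Bundles using (TotalOrder)
open import Relation.Binary.Structures using (IsTotalOrder; IsEquivalence)
import Relation.Binary.PropositionalEquality as PE
open PE using (_≡_)
open import Relation.Nullary using (¬_; yes; no; does)
open import Relation.Nullary.Decidable using (dec-true)

private
  module ⇔ {ℓ} = IsEquivalence (⇔-isEquivalence {ℓ})
  module FinMembership {m} = DecMembership (_≟_ {m})
open FinMembership using (_∈?_)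

module _ {a b} {A : Set a} {B : Set b} (f : A → Maybe B) where

  ∈-mapMaybe⁺ : ∀ {xs x y} → x ∈ xs → f x ≡ just y → y ∈ mapMaybe f xs
  ∈-mapMaybe⁺ (here PE.refl) fx≡y rewrite fx≡y = here PE.refl
  ∈-mapMaybe⁺ {x′ ∷ _} (there x∈xs) fx≡y with f x′
  ... | nothing = ∈-mapMaybe⁺ x∈xs fx≡y
  ... | just _  = there (∈-mapMaybe⁺ x∈xs fx≡y)

  ∈-mapMaybe⁻ : ∀ xs {y} → y ∈ mapMaybe f xs → ∃ λ x → x ∈ xs × f x ≡ just y
  ∈-mapMaybe⁻ (x ∷ xs) y∈ with f x in fx | y∈
  ... | just _  | here PE.refl = x , here PE.refl , fx
  ... | just _  | there y∈xs   = Product.map₂ (Product.map₁ there) (∈-mapMaybe⁻ xs y∈xs)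
  ... | nothing | y∈xs         = Product.map₂ (Product.map₁ there) (∈-mapMaybe⁻ xs y∈xs)

nothing≢just : ∀ {A : Set} {a : A} → ¬ nothing ≡ just a
nothing≢just ()

contains⇒true : ∀ {n d} {S : BMat n d} {σ : PMap d n} → Contains S σ →
                ∀ {i j} → σ j ≡ just i → S i j ≡ true
contains⇒true {S = S} {σ} σ⊆S {i} {j} σj≡i =
  BoolP.≤-antisym (BoolP.≤-maximum (S i j)) (PE.subst (Bool._≤ S i j) σ∋i (σ⊆S i j))
  where
  σ∋i : toBMat σ i j ≡ true
  σ∋i rewrite σj≡i = dec-true (i ≟ i) PE.refl

true⇒contains : ∀ {n d} {S : BMat n d} {σ : PMap d n} →
                (∀ {i j} → σ j ≡ just i → S i j ≡ true) → Contains S σ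
true⇒contains {S = S} {σ} σ⊆S i j with σ j in σj
... | nothing = BoolP.≤-minimum (S i j)
... | just i′ with i′ ≟ i
...   | no _        = BoolP.≤-minimum (S i j)
...   | yes PE.refl rewrite σ⊆S σj = BoolP.≤-refl

-- Association lists from columns to rows

module _ {d n : ℕ} where

  keys : List (Fin d × Fin n) → List (Fin d)
  keys = map proj₁

  values : List (Fin d × Fin n) → List (Fin n)
  values = map proj₂

  lookup : List (Fin d × Fin n) → PMap d n
  lookup []              j = nothing
  lookup ((j₀ , i₀) ∷ L) j = if does (j₀ ≟ j) then just i₀ else lookup L j

  lookup-here : ∀ j i L → lookup ((j , i) ∷ L) j ≡ just i
  lookup-here j i L with j ≟ j
  ... | yes _   = PE.refl
  ... | no j≢j = ⊥-elim (j≢j PE.refl)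

  lookup-there : ∀ {j₀ j} i₀ L → ¬ j₀ ≡ j → lookup ((j₀ , i₀) ∷ L) j ≡ lookup L j
  lookup-there {j₀} {j} i₀ L j₀≢j with j₀ ≟ j
  ... | yes j₀≡j = ⊥-elim (j₀≢j j₀≡j)
  ... | no _     = PE.refl

  lookup⇒∈ : ∀ L {j i} → lookup L j ≡ just i → (j , i) ∈ L
  lookup⇒∈ ((j₀ , i₀) ∷ L) {j} L[j]≡i with j₀ ≟ j
  lookup⇒∈ ((j₀ , i₀) ∷ L) PE.refl | yes PE.refl = here PE.refl
  ... | no _ = there (lookup⇒∈ L L[j]≡i)

  lookup⇒∈keys : ∀ L {j i} → lookup L j ≡ just i → j ∈ keys L
  lookup⇒∈keys L = ∈-map⁺ proj₁ ∘ lookup⇒∈ L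

  lookup⇒∈values : ∀ L {j i} → lookup L j ≡ just i → i ∈ values L
  lookup⇒∈values L = ∈-map⁺ proj₂ ∘ lookup⇒∈ L

  ∉keys⇒lookup≡nothing : ∀ L {j} → j ∉ keys L → lookup L j ≡ nothing
  ∉keys⇒lookup≡nothing L {j} j∉L with lookup L j in L[j]
  ... | nothing = PE.refl
  ... | just i  = ⊥-elim (j∉L (lookup⇒∈keys L L[j]))

  lookup-injective : ∀ L → Unique (values L) → IsPartialBijection (lookup L)
  lookup-injective ((j₀ , i₀) ∷ L) (i₀∉L ∷ unique) j j′ i L[j]≡i L[j′]≡i with j₀ ≟ j | j₀ ≟ j′
  ... | yes j₀≡j | yes j₀≡j′ = PE.trans (PE.sym j₀≡j) j₀≡j′
  lookup-injective ((j₀ , i₀) ∷ L) (i₀∉L ∷ _) j j′ i PE.refl L[j′]≡i | yes _ | no _ =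
    ⊥-elim (All¬⇒¬Any i₀∉L (lookup⇒∈values L L[j′]≡i))
  lookup-injective ((j₀ , i₀) ∷ L) (i₀∉L ∷ _) j j′ i L[j]≡i PE.refl | no _ | yes _ =
    ⊥-elim (All¬⇒¬Any i₀∉L (lookup⇒∈values L L[j]≡i))
  ... | no _ | no _ = lookup-injective L unique j j′ i L[j]≡i L[j′]≡i

  lookup-domain : ∀ L j → InDom (lookup L) j ⇔ j ∈ keys L
  lookup-domain L j = mk⇔ (lookup⇒∈keys L ∘ proj₂) (∈keys⇒InDom L)
    where
    ∈keys⇒InDom : ∀ L → j ∈ keys L → InDom (lookup L) j
    ∈keys⇒InDom ((j₀ , i₀) ∷ L) j∈ with j₀ ≟ j | j∈
    ... | yes _    | _              = i₀ , PE.refl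
    ... | no j₀≢j | here j≡j₀      = ⊥-elim (j₀≢j (PE.sym j≡j₀))
    ... | no _     | there j∈L      = ∈keys⇒InDom L j∈L

  lookup-image : ∀ L → Unique (keys L) → ∀ i → InImg (lookup L) i ⇔ i ∈ values L
  lookup-image L unique i = mk⇔ (lookup⇒∈values L ∘ proj₂) (∈values⇒InImg L unique)
    where
    ∈values⇒InImg : ∀ L → Unique (keys L) → i ∈ values L → InImg (lookup L) i
    ∈values⇒InImg ((j₀ , i₀) ∷ L) _ (here PE.refl) = j₀ , lookup-here j₀ i₀ L
    ∈values⇒InImg ((j₀ , i₀) ∷ L) (j₀∉L ∷ unique) (there i∈L) with ∈values⇒InImg L unique i∈L
    ... | j , L[j]≡i = j , PE.trans (lookup-there i₀ L j₀≢j) L[j]≡i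
      where
      j₀≢j : ¬ j₀ ≡ j
      j₀≢j PE.refl = All¬⇒¬Any j₀∉L (lookup⇒∈keys L L[j]≡i)

module _ {c ℓ₁ ℓ₂} (F : OrderedField c ℓ₁ ℓ₂) where
  open OrderedField F hiding (zero; _≤_)
  open import Algebra.Properties.Group +-group using (//-rightDividesˡ; //-rightDividesʳ)
  open import Algebra.Properties.AbelianGroup +-abelianGroup using (⁻¹-∙-comm)
  open import Algebra.Solver.CommutativeMonoid +-commutativeMonoid using (solve; _⊕_; _⊜_)
  open import Algebra.Properties.CommutativeMonoid.Sum +-commutativeMonoid
    using (sum; sum-cong-≋; ∑-distrib-+; ∑-comm; sum-replicate-zero)
  open import Relation.Binary.Reasoning.Setoid setoid
  private module ≤ = IsTotalOrder isTotalOrder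

  infix 4 _≤_
  _≤_ : Carrier → Carrier → Set ℓ₂
  _≤_ = OrderedField._≤_ F

  ≤-resp-≈ : ∀ {x y x′ y′} → x ≈ x′ → y ≈ y′ → x ≤ y → x′ ≤ y′
  ≤-resp-≈ x≈x′ y≈y′ = ≤.≤-respˡ-≈ x≈x′ ∘ ≤.≤-respʳ-≈ y≈y′

  +-mono-≤₂ : ∀ {x y z w} → x ≤ y → z ≤ w → x + z ≤ y + w
  +-mono-≤₂ {x} {y} {z} {w} x≤y z≤w =
    ≤.trans (+-mono-≤ z x≤y) (≤-resp-≈ (+-comm z y) (+-comm w y) (+-mono-≤ y z≤w))

  +-cancelʳ-≤ : ∀ {x y} z → x + z ≤ y + z → x ≤ y
  +-cancelʳ-≤ {x} {y} z h = ≤-resp-≈ (//-rightDividesʳ z x) (//-rightDividesʳ z y) (+-mono-≤ (- z) h)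

  +-cancelˡ-≤ : ∀ {x y} z → z + x ≤ z + y → x ≤ y
  +-cancelˡ-≤ z h = +-cancelʳ-≤ z (≤-resp-≈ (+-comm z _) (+-comm z _) h)

  x-z≤y⇒x≤y+z : ∀ {x y z} → x - z ≤ y → x ≤ y + z
  x-z≤y⇒x≤y+z {x} {z = z} h = ≤-resp-≈ (//-rightDividesˡ z x) refl (+-mono-≤ z h)

  x≤y+z⇒x-z≤y : ∀ {x y z} → x ≤ y + z → x - z ≤ y
  x≤y+z⇒x-z≤y {y = y} {z} h = ≤-resp-≈ refl (//-rightDividesʳ z y) (+-mono-≤ (- z) h)

  x≤y-z⇒x+z≤y : ∀ {x y z} → x ≤ y - z → x + z ≤ y
  x≤y-z⇒x+z≤y {y = y} {z} h = ≤-resp-≈ refl (//-rightDividesˡ z y) (+-mono-≤ z h)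

  y≤x⇒0≤x-y : ∀ {x y} → y ≤ x → 0# ≤ x - y
  y≤x⇒0≤x-y {y = y} h = ≤-resp-≈ (-‿inverseʳ y) refl (+-mono-≤ (- y) h)

  x-y≤z⇒x-z≤y : ∀ {x y z} → x - y ≤ z → x - z ≤ y
  x-y≤z⇒x-z≤y h = x≤y+z⇒x-z≤y (≤-resp-≈ refl (+-comm _ _) (x-z≤y⇒x≤y+z h))

  x-y≤z+w⇒x-z≤w+y : ∀ {x y z w} → x - y ≤ z + w → x - z ≤ w + y
  x-y≤z+w⇒x-z≤w+y {y = y} {z} {w} h = x≤y+z⇒x-z≤y (≤-resp-≈ refl shuffle (x-z≤y⇒x≤y+z h))
    where
    shuffle : (z + w) + y ≈ (w + y) + z
    shuffle = solve 3 (λ z w y → (z ⊕ w) ⊕ y ⊜ (w ⊕ y) ⊕ z) refl z w y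

  x-y≤z-w⇒x-z≤y-w : ∀ {x y z w} → x - y ≤ z - w → x - z ≤ y - w
  x-y≤z-w⇒x-z≤y-w {y = y} {z} {w} h = x≤y+z⇒x-z≤y (≤-resp-≈ refl shuffle (x-z≤y⇒x≤y+z h))
    where
    shuffle : (z - w) + y ≈ (y - w) + z
    shuffle = solve 3 (λ z -w y → (z ⊕ -w) ⊕ y ⊜ (y ⊕ -w) ⊕ z) refl z (- w) y

  x-y≤z-w⇒x+w≤z+y : ∀ {x y z w} → x - y ≤ z - w → x + w ≤ z + y
  x-y≤z-w⇒x+w≤z+y {y = y} {z} {w} h = x≤y-z⇒x+z≤y (≤-resp-≈ refl shuffle (x-z≤y⇒x≤y+z h))
    where
    shuffle : (z - w) + y ≈ (z + y) - w
    shuffle = solve 3 (λ z -w y → (z ⊕ -w) ⊕ y ⊜ (z ⊕ y) ⊕ -w) refl z (- w) y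

  [x-y]+[z-w]≈[x+z]-[y+w] : ∀ x y z w → (x - y) + (z - w) ≈ (x + z) - (y + w)
  [x-y]+[z-w]≈[x+z]-[y+w] x y z w = begin
    (x - y) + (z - w)
      ≈⟨ solve 4 (λ x -y z -w → (x ⊕ -y) ⊕ (z ⊕ -w) ⊜ (x ⊕ z) ⊕ (-y ⊕ -w)) refl x (- y) z (- w) ⟩
    (x + z) + (- y + - w)
      ≈⟨ +-congˡ (⁻¹-∙-comm y w) ⟩
    (x + z) - (y + w)
      ∎

  sumFin≡sum : ∀ {d} (f : Fin d → Carrier) → sumFin F f ≡ sum f
  sumFin≡sum {ℕ.zero}  f = PE.refl
  sumFin≡sum {ℕ.suc d} f = PE.cong (f zero +_) (sumFin≡sum (f ∘ suc))

  sum-mono-≤ : ∀ {d} {f g : Fin d → Carrier} → (∀ j → f j ≤ g j) → sum f ≤ sum g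
  sum-mono-≤ {ℕ.zero}  f≤g = ≤.refl
  sum-mono-≤ {ℕ.suc d} f≤g = +-mono-≤₂ (f≤g zero) (sum-mono-≤ (f≤g ∘ suc))

  sum-δ : ∀ {d} (j₀ : Fin d) (f : Fin d → Carrier) →
          sum (λ j → if does (j₀ ≟ j) then f j else 0#) ≈ f j₀
  sum-δ {ℕ.suc d} zero     f = trans (+-congˡ (sum-replicate-zero d)) (+-identityʳ _)
  sum-δ {ℕ.suc d} (suc j₀) f = trans (+-congˡ (sum-δ j₀ (f ∘ suc))) (+-identityˡ _)

  module _ {n d : ℕ} (x : Fin n → Carrier) where

    spike : Maybe (Fin n) → Fin n → Carrier
    spike m i = maybe (λ i′ → if does (i′ ≟ i) then x i else 0#) 0# m

    sum-spike : ∀ m → sum (spike m) ≈ maybe x 0# m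
    sum-spike nothing   = sum-replicate-zero n
    sum-spike (just i₀) = sum-δ i₀ x

    spike-≢ : ∀ m i → ¬ m ≡ just i → spike m i ≈ 0#
    spike-≢ nothing   i _ = refl
    spike-≢ (just i₀) i m≢i with i₀ ≟ i
    ... | yes PE.refl = ⊥-elim (m≢i PE.refl)
    ... | no _        = refl

    spike-≡ : ∀ i → spike (just i) i ≈ x i
    spike-≡ i with i ≟ i
    ... | yes _   = refl
    ... | no i≢i = ⊥-elim (i≢i PE.refl)

    column-outsideImage : (σ : PMap d n) (i : Fin n) → ¬ InImg σ i →
                          sum (λ j → spike (σ j) i) ≈ 0#
    column-outsideImage σ i i∉σ =
      trans (sum-cong-≋ (λ j → spike-≢ (σ j) i (λ σj≡i → i∉σ (j , σj≡i))))
            (sum-replicate-zero d)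

    column-inImage : (σ : PMap d n) → IsPartialBijection σ → ∀ {i j₀} → σ j₀ ≡ just i →
                     sum (λ j → spike (σ j) i) ≈ x i
    column-inImage σ σ-inj {i} {j₀} σj₀≡i = trans (sum-cong-≋ column≈δ) (sum-δ j₀ (λ _ → x i))
      where
      column≈δ : ∀ j → spike (σ j) i ≈ (if does (j₀ ≟ j) then x i else 0#)
      column≈δ j with j₀ ≟ j
      ... | yes PE.refl = PE.subst (λ m → spike m i ≈ x i) (PE.sym σj₀≡i) (spike-≡ i)
      ... | no j₀≢j     = spike-≢ (σ j) i (j₀≢j ∘ σ-inj j₀ j i σj₀≡i)

    -- Both sums equal ∑ᵢ ∑ⱼ spike (σ j) i, whose i-th column only depends on whether i is in the image.
    sum-sameImage : (σ τ : PMap d n) → IsPartialBijection σ → IsPartialBijection τ →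
                    (∀ i → InImg τ i ⇔ InImg σ i) →
                    sum (maybe x 0# ∘ σ) ≈ sum (maybe x 0# ∘ τ)
    sum-sameImage σ τ σ-inj τ-inj sameImage = begin
      sum (maybe x 0# ∘ σ)                   ≈⟨ sum-cong-≋ (sym ∘ sum-spike ∘ σ) ⟩
      sum (λ j → sum (λ i → spike (σ j) i))  ≈⟨ ∑-comm (λ j i → spike (σ j) i) ⟩
      sum (λ i → sum (λ j → spike (σ j) i))  ≈⟨ sum-cong-≋ sameColumn ⟩
      sum (λ i → sum (λ j → spike (τ j) i))  ≈⟨ ∑-comm (λ j i → spike (τ j) i) ⟨
      sum (λ j → sum (λ i → spike (τ j) i))  ≈⟨ sum-cong-≋ (sum-spike ∘ τ) ⟩
      sum (maybe x 0# ∘ τ)                   ∎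
      where
      sameColumn : ∀ i → sum (λ j → spike (σ j) i) ≈ sum (λ j → spike (τ j) i)
      sameColumn i with FinP.any? (λ j → MaybeP.≡-dec _≟_ (σ j) (just i))
      ... | yes i∈σ = trans (column-inImage σ σ-inj (proj₂ i∈σ))
                            (sym (column-inImage τ τ-inj (proj₂ (Equivalence.from (sameImage i) i∈σ))))
      ... | no i∉σ  = trans (column-outsideImage σ i i∉σ)
                            (sym (column-outsideImage τ i (i∉σ ∘ Equivalence.to (sameImage i))))

  -- Satisfiable ⇒ permanent-attaining

  module _ {n d : ℕ} (M : Mat F n d) where

    entry : Maybe (Fin n) → Fin d → Carrier
    entry m j = maybe (λ i → M i j) 0# m

    pmSum≈sum : (τ : PMap d n) → pmSum F M τ ≈ sum (λ j → entry (τ j) j)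
    pmSum≈sum τ = reflexive (sumFin≡sum (λ j → entry (τ j) j))

    listSum : List (Fin d × Fin n) → Carrier
    listSum []            = 0#
    listSum ((j , i) ∷ L) = M i j + listSum L

    pmSum-lookup : ∀ L → Unique (keys L) → pmSum F M (lookup L) ≈ listSum L
    pmSum-lookup [] _ = trans (pmSum≈sum (lookup [])) (sum-replicate-zero d)
    pmSum-lookup ((j₀ , i₀) ∷ L) (j₀∉L ∷ unique) = begin
      pmSum F M (lookup ((j₀ , i₀) ∷ L))
        ≈⟨ pmSum≈sum (lookup ((j₀ , i₀) ∷ L)) ⟩
      sum (λ j → entry (lookup ((j₀ , i₀) ∷ L) j) j)
        ≈⟨ sum-cong-≋ split ⟩
      sum (λ j → δ j + entry (lookup L j) j)
        ≈⟨ ∑-distrib-+ δ (λ j → entry (lookup L j) j) ⟩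
      sum δ + sum (λ j → entry (lookup L j) j)
        ≈⟨ +-cong (sum-δ j₀ (M i₀)) (sym (pmSum≈sum (lookup L))) ⟩
      M i₀ j₀ + pmSum F M (lookup L)
        ≈⟨ +-congˡ (pmSum-lookup L unique) ⟩
      M i₀ j₀ + listSum L
        ∎
      where
      δ : Fin d → Carrier
      δ j = if does (j₀ ≟ j) then M i₀ j else 0#

      split : ∀ j → entry (lookup ((j₀ , i₀) ∷ L) j) j ≈ δ j + entry (lookup L j) j
      split j with j₀ ≟ j
      ... | yes PE.refl rewrite ∉keys⇒lookup≡nothing L (All¬⇒¬Any j₀∉L) = sym (+-identityʳ _)
      ... | no _ = sym (+-identityˡ _)

    satisfiable⇒permanentAttaining : (S : BMat n d) → Satisfiable F M S →
      ∀ σ → IsPartialBijection σ → Contains S σ → PermanentAttaining F M σ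
    satisfiable⇒permanentAttaining S (x , x-sat) σ σ-inj σ⊆S τ (τ-inj , sameDomain , sameImage) =
      ≤-resp-≈ (sym (pmSum≈sum τ)) (sym (pmSum≈sum σ)) (+-cancelˡ-≤ (sum (xAt ∘ σ)) summed)
      where
      xAt : Maybe (Fin n) → Carrier
      xAt = maybe x 0#

      exchange : ∀ j → xAt (σ j) + entry (τ j) j ≤ xAt (τ j) + entry (σ j) j
      exchange j with σ j in σj | τ j in τj
      ... | just i  | just k  = x-y≤z-w⇒x+w≤z+y (x-sat i j (contains⇒true {σ = σ} σ⊆S σj) k)
      ... | nothing | nothing = ≤.refl
      ... | just i  | nothing with Equivalence.from (sameDomain j) (i , σj)
      ...   | _ , τj≡k = ⊥-elim (nothing≢just (PE.trans (PE.sym τj) τj≡k))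
      exchange j | nothing | just k with Equivalence.to (sameDomain j) (k , τj)
      ...   | _ , σj≡i = ⊥-elim (nothing≢just (PE.trans (PE.sym σj) σj≡i))

      summed : sum (xAt ∘ σ) + sum (λ j → entry (τ j) j) ≤ sum (xAt ∘ σ) + sum (λ j → entry (σ j) j)
      summed = ≤-resp-≈ (∑-distrib-+ (xAt ∘ σ) (λ j → entry (τ j) j))
                        (trans (∑-distrib-+ (xAt ∘ τ) (λ j → entry (σ j) j))
                               (+-congʳ (sym (sum-sameImage x σ τ σ-inj τ-inj sameImage))))
                        (sum-mono-≤ exchange)

  -- Systems of difference constraints

  Constraint : ℕ → Set c
  Constraint n = Fin n × Fin n × Carrier

  Solves : ∀ {n} → (Fin n → Carrier) → List (Constraint n) → Set (c ⊔ ℓ₂)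
  Solves x L = ∀ {u v w} → (u , v , w) ∈ L → x u - x v ≤ w

  data Walk {n} (L : List (Constraint n)) : Fin n → Fin n → Set c where
    []  : ∀ {u} → Walk L u u
    _∷_ : ∀ {u v t w} → (u , v , w) ∈ L → Walk L v t → Walk L u t

  weight : ∀ {n} {L : List (Constraint n)} {u v} → Walk L u v → Carrier
  weight []                   = 0#
  weight (_∷_ {w = w} _ rest) = w + weight rest

  NoNegativeCycle : ∀ {n} → List (Constraint n) → Set (c ⊔ ℓ₂)
  NoNegativeCycle L = ∀ {u} (cycle : Walk L u u) → 0# ≤ weight cycle

  between : (lo hi : List Carrier) → (∀ {a b} → a ∈ lo → b ∈ hi → a ≤ b) →
            ∃ λ t → (∀ {a} → a ∈ lo → a ≤ t) × (∀ {b} → b ∈ hi → t ≤ b)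
  between lo hi lo≤hi =
    max (min 0# hi) lo ,
    All.lookup (xs≤max _ lo) ,
    λ b∈hi → max≤v⁺ (All.lookup (min≤xs 0# hi) b∈hi) (All.tabulate (λ a∈lo → lo≤hi a∈lo b∈hi))
    where
    totalOrder : TotalOrder c ℓ₁ ℓ₂
    totalOrder = record { isTotalOrder = isTotalOrder }
    open import Data.List.Extrema totalOrder using (max; min; xs≤max; min≤xs; max≤v⁺)

  -- Fourier–Motzkin: a constraint through variable zero bounds it from below or above;
  -- zero is eliminated by combining every lower bound with every upper bound.
  module Elimination {m : ℕ} where

    inner : Constraint (ℕ.suc m) → Maybe (Constraint m)
    inner (suc u , suc v , w) = just (u , v , w)
    inner _                   = nothing

    lower : Constraint (ℕ.suc m) → Maybe (Fin m × Carrier)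
    lower (suc u , zero , w) = just (u , w)
    lower _                  = nothing

    upper : Constraint (ℕ.suc m) → Maybe (Fin m × Carrier)
    upper (zero , suc v , w) = just (v , w)
    upper _                  = nothing

    inner⁻ : ∀ c {u v w} → inner c ≡ just (u , v , w) → c ≡ (suc u , suc v , w)
    inner⁻ (suc u , suc v , w) PE.refl = PE.refl
    inner⁻ (zero  , _     , _) ()
    inner⁻ (suc _ , zero  , _) ()

    lower⁻ : ∀ c {u w} → lower c ≡ just (u , w) → c ≡ (suc u , zero , w)
    lower⁻ (suc u , zero  , w) PE.refl = PE.refl
    lower⁻ (zero  , _     , _) ()
    lower⁻ (suc _ , suc _ , _) ()

    upper⁻ : ∀ c {v w} → upper c ≡ just (v , w) → c ≡ (zero , suc v , w)
    upper⁻ (zero  , suc v , w) PE.refl = PE.refl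
    upper⁻ (zero  , zero  , _) ()
    upper⁻ (suc _ , _     , _) ()

    combine : Fin m × Carrier → Fin m × Carrier → Constraint m
    combine (u , w₁) (v , w₂) = (u , v , w₁ + w₂)

    eliminate : List (Constraint (ℕ.suc m)) → List (Constraint m)
    eliminate L = mapMaybe inner L ++ cartesianProductWith combine (mapMaybe lower L) (mapMaybe upper L)

    liftWalk : ∀ L {u v} (q : Walk (eliminate L) u v) →
               ∃ λ (p : Walk L (suc u) (suc v)) → weight p ≈ weight q
    liftWalk L [] = [] , refl
    liftWalk L (c∈ ∷ q) with liftWalk L q | ∈-++⁻ (mapMaybe inner L) c∈
    ... | p , p≈q | inj₁ c∈inner with ∈-mapMaybe⁻ inner L c∈inner
    ...   | c , c∈L , e rewrite inner⁻ c e = (c∈L ∷ p) , +-congˡ p≈q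
    liftWalk L (c∈ ∷ q) | p , p≈q | inj₂ c∈combined
      with ∈-cartesianProductWith⁻ combine (mapMaybe lower L) (mapMaybe upper L) c∈combined
    ... | (u , w₁) , (v , w₂) , l∈ , h∈ , PE.refl
      with ∈-mapMaybe⁻ lower L l∈ | ∈-mapMaybe⁻ upper L h∈
    ...   | cₗ , cₗ∈L , eₗ | cₕ , cₕ∈L , eₕ rewrite lower⁻ cₗ eₗ | upper⁻ cₕ eₕ =
      (cₗ∈L ∷ (cₕ∈L ∷ p)) , trans (+-congˡ (+-congˡ p≈q)) (sym (+-assoc w₁ w₂ (weight q)))

    eliminate-noNegativeCycle : ∀ L → NoNegativeCycle L → NoNegativeCycle (eliminate L)
    eliminate-noNegativeCycle L noNeg cycle =
      let p , p≈cycle = liftWalk L cycle in ≤-resp-≈ refl p≈cycle (noNeg p)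

    extend : ∀ L → NoNegativeCycle L → ∀ {x′} → Solves x′ (eliminate L) → ∃ λ x → Solves x L
    extend L noNeg {x′} x′-solves = x , x-solves
      where
      lowerBound upperBound : Fin m × Carrier → Carrier
      lowerBound (u , w) = x′ u - w
      upperBound (v , w) = w + x′ v

      lows highs : List Carrier
      lows  = map lowerBound (mapMaybe lower L)
      highs = map upperBound (mapMaybe upper L)

      lo≤hi : ∀ {a b} → a ∈ lows → b ∈ highs → a ≤ b
      lo≤hi a∈ b∈ with ∈-map⁻ lowerBound a∈ | ∈-map⁻ upperBound b∈
      ... | l , l∈ , PE.refl | h , h∈ , PE.refl =
        x-y≤z+w⇒x-z≤w+y (x′-solves (∈-++⁺ʳ (mapMaybe inner L) (∈-cartesianProductWith⁺ combine l∈ h∈)))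

      t : Carrier
      t = proj₁ (between lows highs lo≤hi)

      lo≤t : ∀ {a} → a ∈ lows → a ≤ t
      lo≤t = proj₁ (proj₂ (between lows highs lo≤hi))

      t≤hi : ∀ {b} → b ∈ highs → t ≤ b
      t≤hi = proj₂ (proj₂ (between lows highs lo≤hi))

      x : Fin (ℕ.suc m) → Carrier
      x zero    = t
      x (suc i) = x′ i

      x-solves : Solves x L
      x-solves {zero} {zero} {w} c∈ =
        ≤-resp-≈ (sym (-‿inverseʳ t)) (+-identityʳ w) (noNeg (c∈ ∷ []))
      x-solves {zero} {suc v} c∈ =
        x≤y+z⇒x-z≤y (t≤hi (∈-map⁺ upperBound (∈-mapMaybe⁺ upper c∈ PE.refl)))
      x-solves {suc u} {zero} c∈ =
        x-y≤z⇒x-z≤y (lo≤t (∈-map⁺ lowerBound (∈-mapMaybe⁺ lower c∈ PE.refl)))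
      x-solves {suc u} {suc v} c∈ = x′-solves (∈-++⁺ˡ (∈-mapMaybe⁺ inner c∈ PE.refl))

  noNegativeCycle⇒solvable : ∀ {n} (L : List (Constraint n)) → NoNegativeCycle L → ∃ λ x → Solves x L
  noNegativeCycle⇒solvable {ℕ.zero}  L _     = (λ ()) , λ { {()} }
  noNegativeCycle⇒solvable {ℕ.suc m} L noNeg =
    extend L noNeg (proj₂ (noNegativeCycle⇒solvable (eliminate L) (eliminate-noNegativeCycle L noNeg)))
    where open Elimination

  -- The exchange graph of (M, S)

  module _ {n d : ℕ} (M : Mat F n d) (S : BMat n d) where

    data Path : Fin n → Fin n → Set where
      []   : ∀ {a} → Path a a
      step : ∀ {a b} j k → S a j ≡ true → Path k b → Path a b

    length : ∀ {a b} → Path a b → ℕ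
    length []             = 0
    length (step _ _ _ p) = ℕ.suc (length p)

    pathWeight : ∀ {a b} → Path a b → Carrier
    pathWeight []                 = 0#
    pathWeight (step {a} j k _ p) = (M a j - M k j) + pathWeight p

    _++ₚ_ : ∀ {a b e} → Path a b → Path b e → Path a e
    []           ++ₚ q = q
    step j k s p ++ₚ q = step j k s (p ++ₚ q)

    length-++ : ∀ {a b e} (p : Path a b) (q : Path b e) → length (p ++ₚ q) ≡ length p Nat.+ length q
    length-++ []             q = PE.refl
    length-++ (step _ _ _ p) q = PE.cong ℕ.suc (length-++ p q)

    pathWeight-++ : ∀ {a b e} (p : Path a b) (q : Path b e) →
                    pathWeight (p ++ₚ q) ≈ pathWeight p + pathWeight q
    pathWeight-++ []             q = sym (+-identityˡ _)
    pathWeight-++ (step _ _ _ p) q = trans (+-congˡ (pathWeight-++ p q)) (sym (+-assoc _ _ _))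

    sourcePairs targetPairs : ∀ {a b} → Path a b → List (Fin d × Fin n)
    sourcePairs []                 = []
    sourcePairs (step {a} j _ _ p) = (j , a) ∷ sourcePairs p
    targetPairs []                 = []
    targetPairs (step j k _ p)     = (j , k) ∷ targetPairs p

    keys-targetPairs : ∀ {a b} (p : Path a b) → keys (targetPairs p) ≡ keys (sourcePairs p)
    keys-targetPairs []             = PE.refl
    keys-targetPairs (step j _ _ p) = PE.cong (j ∷_) (keys-targetPairs p)

    sourcePairs⊆S : ∀ {a b} (p : Path a b) {j i} → (j , i) ∈ sourcePairs p → S i j ≡ true
    sourcePairs⊆S (step j k s p) (here PE.refl) = s
    sourcePairs⊆S (step j k s p) (there j,i∈p) = sourcePairs⊆S p j,i∈p

    pathWeight≈listSum : ∀ {a b} (p : Path a b) →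
                         pathWeight p ≈ listSum M (sourcePairs p) - listSum M (targetPairs p)
    pathWeight≈listSum []                 = sym (-‿inverseʳ 0#)
    pathWeight≈listSum (step {a} j k _ p) =
      trans (+-congˡ (pathWeight≈listSum p)) ([x-y]+[z-w]≈[x+z]-[y+w] (M a j) (M k j) _ _)

    sources-targets : ∀ {a b} (p : Path a b) →
                      values (sourcePairs p) ++ b ∷ [] ≡ a ∷ values (targetPairs p)
    sources-targets []                 = PE.refl
    sources-targets (step {a} _ _ _ p) = PE.cong (a ∷_) (sources-targets p)

    end∈targets : ∀ {a k b} j (s : S a j ≡ true) (p : Path k b) → b ∈ values (targetPairs (step j k s p))
    end∈targets _ _ []               = here PE.refl
    end∈targets _ _ (step j′ _ s′ p) = there (end∈targets j′ s′ p)

    cycle-sameRows : ∀ {a} (c : Path a a) i → i ∈ values (targetPairs c) ⇔ i ∈ values (sourcePairs c)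
    cycle-sameRows []               i = mk⇔ (λ ()) (λ ())
    cycle-sameRows c@(step j k s p) i = mk⇔ target⇒source source⇒target
      where
      target⇒source : i ∈ values (targetPairs c) → i ∈ values (sourcePairs c)
      target⇒source i∈
        with ∈-++⁻ (values (sourcePairs c)) (PE.subst (i ∈_) (PE.sym (sources-targets c)) (there i∈))
      ... | inj₁ i∈sources      = i∈sources
      ... | inj₂ (here PE.refl) = here PE.refl

      source⇒target : i ∈ values (sourcePairs c) → i ∈ values (targetPairs c)
      source⇒target i∈ with PE.subst (i ∈_) (sources-targets c) (∈-++⁺ˡ i∈)
      ... | there i∈targets = i∈targets
      ... | here PE.refl    = end∈targets j s p

    record Occurrence {a b} (p : Path a b) (j : Fin d) (u v : Fin n) : Set where
      field
        prefix        : Path a u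
        edge          : S u j ≡ true
        suffix        : Path v b
        decomposition : p ≡ prefix ++ₚ step j v edge suffix

    occurrence-step : ∀ {a b j′ k′ u v j} (s′ : S a j′ ≡ true) {p : Path k′ b} →
                      Occurrence p j u v → Occurrence (step j′ k′ s′ p) j u v
    occurrence-step {j′ = j′} {k′} s′ o = record
      { prefix = step j′ k′ s′ prefix ; edge = edge ; suffix = suffix
      ; decomposition = PE.cong (step j′ k′ s′) decomposition }
      where open Occurrence o

    occurrence-here : ∀ {a k b} j (s : S a j ≡ true) (p : Path k b) → Occurrence (step j k s p) j a k
    occurrence-here j s p = record { prefix = [] ; edge = s ; suffix = p ; decomposition = PE.refl }

    column-occurrence : ∀ {a b} (p : Path a b) {j} → j ∈ keys (sourcePairs p) →
                        ∃₂ λ u v → Occurrence p j u v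
    column-occurrence (step {a} j k s p) (here PE.refl) = a , k , occurrence-here j s p
    column-occurrence (step j k s p) (there j∈p) =
      Product.map₂ (Product.map₂ (occurrence-step s)) (column-occurrence p j∈p)

    source-occurrence : ∀ {a b} (p : Path a b) {u} → u ∈ values (sourcePairs p) →
                        ∃₂ λ j v → Occurrence p j u v
    source-occurrence (step j k s p) (here PE.refl) = j , k , occurrence-here j s p
    source-occurrence (step j k s p) (there u∈p) =
      Product.map₂ (Product.map₂ (occurrence-step s)) (source-occurrence p u∈p)

    target-occurrence : ∀ {a b} (p : Path a b) {v} → v ∈ values (targetPairs p) →
                        ∃₂ λ j u → Occurrence p j u v
    target-occurrence (step {a} j k s p) (here PE.refl) = j , a , occurrence-here j s p
    target-occurrence (step j k s p) (there v∈p) =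
      Product.map₂ (Product.map₂ (occurrence-step s)) (target-occurrence p v∈p)

    prefix<length : ∀ {a u v b j} (q : Path a u) (s : S u j ≡ true) (r : Path v b) →
                    length q Nat.< length (q ++ₚ step j v s r)
    prefix<length q s r rewrite length-++ q (step _ _ s r) = NatP.m<m+n (length q) (Nat.s≤s Nat.z≤n)

    suffix<length : ∀ {a u v b j} (q : Path a u) (s : S u j ≡ true) (r : Path v b) →
                    length r Nat.< length (q ++ₚ step j v s r)
    suffix<length q s r rewrite length-++ q (step _ _ s r) = NatP.m≤n+m (ℕ.suc (length r)) (length q)

    Simple : ∀ {a b} → Path a b → Set
    Simple p = Unique (keys (sourcePairs p)) × Unique (values (sourcePairs p)) × Unique (values (targetPairs p))

    record Shortcut {a b} (p : Path a b) : Set ℓ₁ where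
      field
        {v}           : Fin n
        cycle         : Path v v
        rest          : Path a b
        cycle-shorter : length cycle Nat.< length p
        rest-shorter  : length rest Nat.< length p
        weight-split  : pathWeight p ≈ pathWeight cycle + pathWeight rest

    shortcut-step : ∀ {a k b j} (s : S a j ≡ true) {r : Path k b} → Shortcut r → Shortcut (step j k s r)
    shortcut-step {a} {k} {j = j} s {r} sc = record
      { cycle = cycle ; rest = step j k s rest
      ; cycle-shorter = NatP.m<n⇒m<1+n cycle-shorter
      ; rest-shorter = Nat.s≤s rest-shorter
      ; weight-split = begin
          e + pathWeight r
            ≈⟨ +-congˡ weight-split ⟩
          e + (pathWeight cycle + pathWeight rest)
            ≈⟨ solve 3 (λ e c r → e ⊕ (c ⊕ r) ⊜ c ⊕ (e ⊕ r)) refl e _ _ ⟩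
          pathWeight cycle + (e + pathWeight rest)
            ∎ }
      where
      open Shortcut sc
      e : Carrier
      e = M a j - M k j

    -- The repeated column j is used once from row a and once from row u; swap the two targets.
    shortcut-column : ∀ {a k b j u v} (s : S a j ≡ true) {r : Path k b} → Occurrence r j u v →
                      Shortcut (step j k s r)
    shortcut-column {a} {k} {j = j} {u} {v} s
      record { prefix = q ; edge = sᵤ ; suffix = r′ ; decomposition = PE.refl } = record
      { cycle = step j k sᵤ q ; rest = step j v s r′
      ; cycle-shorter = Nat.s≤s (prefix<length q sᵤ r′)
      ; rest-shorter = Nat.s≤s (suffix<length q sᵤ r′)
      ; weight-split = begin
          (M a j - M k j) + pathWeight (q ++ₚ step j v sᵤ r′)
            ≈⟨ +-congˡ (pathWeight-++ q _) ⟩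
          (M a j - M k j) + (pathWeight q + ((M u j - M v j) + pathWeight r′))
            ≈⟨ solve 6 (λ a -k q u -v r → (a ⊕ -k) ⊕ (q ⊕ ((u ⊕ -v) ⊕ r)) ⊜ ((u ⊕ -k) ⊕ q) ⊕ ((a ⊕ -v) ⊕ r))
                       refl (M a j) (- M k j) (pathWeight q) (M u j) (- M v j) (pathWeight r′) ⟩
          ((M u j - M k j) + pathWeight q) + ((M a j - M v j) + pathWeight r′)  ∎ }

    shortcut-source : ∀ {a k b j j′ v} (s : S a j ≡ true) {r : Path k b} → Occurrence r j′ a v →
                      Shortcut (step j k s r)
    shortcut-source {a} {k} {j = j} {j′} {v} s
      record { prefix = q ; edge = sₐ ; suffix = r′ ; decomposition = PE.refl } = record
      { cycle = step j k s q ; rest = step j′ v sₐ r′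
      ; cycle-shorter = Nat.s≤s (prefix<length q sₐ r′)
      ; rest-shorter = Nat.s≤s (suffix<length q sₐ r′)
      ; weight-split = trans (+-congˡ (pathWeight-++ q _)) (sym (+-assoc _ _ _)) }

    shortcut-target : ∀ {a k b j j′ u} (s : S a j ≡ true) {r : Path k b} → Occurrence r j′ u k →
                      Shortcut (step j k s r)
    shortcut-target {a} {k} {j = j} {j′} {u} s
      record { prefix = q ; edge = sᵤ ; suffix = r′ ; decomposition = PE.refl } = record
      { cycle = q ++ₚ step j′ k sᵤ [] ; rest = step j k s r′
      ; cycle-shorter = Nat.s≤s cycle≤
      ; rest-shorter = Nat.s≤s (suffix<length q sᵤ r′)
      ; weight-split = begin
          e + pathWeight (q ++ₚ step j′ k sᵤ r′)
            ≈⟨ +-congˡ (pathWeight-++ q _) ⟩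
          e + (pathWeight q + (e′ + pathWeight r′))
            ≈⟨ solve 4 (λ e q e′ r → e ⊕ (q ⊕ (e′ ⊕ r)) ⊜ (q ⊕ e′) ⊕ (e ⊕ r)) refl e (pathWeight q) e′ (pathWeight r′) ⟩
          (pathWeight q + e′) + (e + pathWeight r′)
            ≈⟨ +-congʳ (+-congˡ (sym (+-identityʳ e′))) ⟩
          (pathWeight q + (e′ + 0#)) + (e + pathWeight r′)
            ≈⟨ +-congʳ (pathWeight-++ q _) ⟨
          pathWeight (q ++ₚ step j′ k sᵤ []) + (e + pathWeight r′)
            ∎ }
      where
      e e′ : Carrier
      e  = M a j - M k j
      e′ = M u j′ - M k j′

      cycle≤ : length (q ++ₚ step j′ k sᵤ []) Nat.≤ length (q ++ₚ step j′ k sᵤ r′)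
      cycle≤ rewrite length-++ q (step j′ k sᵤ []) | length-++ q (step j′ k sᵤ r′) =
        NatP.+-monoʳ-≤ (length q) (Nat.s≤s Nat.z≤n)

    step-simple⊎shortcut : ∀ {a k b j} (s : S a j ≡ true) {r : Path k b} → Simple r →
                           Simple (step j k s r) ⊎ Shortcut (step j k s r)
    step-simple⊎shortcut {a} {k} {j = j} s {r} (columns-unique , sources-unique , targets-unique)
      with j ∈? keys (sourcePairs r) | a ∈? values (sourcePairs r) | k ∈? values (targetPairs r)
    ... | yes j∈ | _      | _      = inj₂ (shortcut-column s (proj₂ (proj₂ (column-occurrence r j∈))))
    ... | no _   | yes a∈ | _      = inj₂ (shortcut-source s (proj₂ (proj₂ (source-occurrence r a∈))))
    ... | no _   | no _   | yes k∈ = inj₂ (shortcut-target s (proj₂ (proj₂ (target-occurrence r k∈))))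
    ... | no j∉  | no a∉  | no k∉  = inj₁ ( ¬Any⇒All¬ _ j∉ ∷ columns-unique
                                          , ¬Any⇒All¬ _ a∉ ∷ sources-unique
                                          , ¬Any⇒All¬ _ k∉ ∷ targets-unique )

    simple⊎shortcut : ∀ {a b} (p : Path a b) → Simple p ⊎ Shortcut p
    simple⊎shortcut []             = inj₁ ([] , [] , [])
    simple⊎shortcut (step j k s r) with simple⊎shortcut r
    ... | inj₁ simple = step-simple⊎shortcut s simple
    ... | inj₂ sc     = inj₂ (shortcut-step s sc)

    PartialBijectionsAttain : Set ℓ₂
    PartialBijectionsAttain = ∀ σ → IsPartialBijection σ → Contains S σ → PermanentAttaining F M σ

    -- σ sends each column of the cycle to the row it leaves, τ to the row it enters.
    simpleCycle-nonnegative : PartialBijectionsAttain → ∀ {a} (c : Path a a) → Simple c → 0# ≤ pathWeight c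
    simpleCycle-nonnegative attain c (columns-unique , sources-unique , targets-unique) =
      ≤-resp-≈ refl (sym (pathWeight≈listSum c)) (y≤x⇒0≤x-y τ≤σ)
      where
      σ τ : PMap d n
      σ = lookup (sourcePairs c)
      τ = lookup (targetPairs c)

      sameKeys : keys (targetPairs c) ≡ keys (sourcePairs c)
      sameKeys = keys-targetPairs c

      target-keys-unique : Unique (keys (targetPairs c))
      target-keys-unique = PE.subst Unique (PE.sym sameKeys) columns-unique

      sameDomain : ∀ j → InDom τ j ⇔ InDom σ j
      sameDomain j = ⇔.trans (lookup-domain (targetPairs c) j)
                    (⇔.trans (mk⇔ (PE.subst (j ∈_) sameKeys) (PE.subst (j ∈_) (PE.sym sameKeys)))
                             (⇔.sym (lookup-domain (sourcePairs c) j)))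

      sameImage : ∀ i → InImg τ i ⇔ InImg σ i
      sameImage i = ⇔.trans (lookup-image (targetPairs c) target-keys-unique i)
                   (⇔.trans (cycle-sameRows c i)
                            (⇔.sym (lookup-image (sourcePairs c) columns-unique i)))

      τ≤σ : listSum M (targetPairs c) ≤ listSum M (sourcePairs c)
      τ≤σ = ≤-resp-≈ (pmSum-lookup M _ target-keys-unique) (pmSum-lookup M _ columns-unique)
              (attain σ (lookup-injective _ sources-unique)
                        (true⇒contains (sourcePairs⊆S c ∘ lookup⇒∈ (sourcePairs c)))
                        τ (lookup-injective _ targets-unique , sameDomain , sameImage))

    cycle-nonnegative : PartialBijectionsAttain → ∀ {a} (c : Path a a) → 0# ≤ pathWeight c
    cycle-nonnegative attain c = go c (<-wellFounded (length c))
      where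
      go : ∀ {a} (c : Path a a) → Acc Nat._<_ (length c) → 0# ≤ pathWeight c
      go c (acc shorter) with simple⊎shortcut c
      ... | inj₁ simple = simpleCycle-nonnegative attain c simple
      ... | inj₂ sc     = ≤-resp-≈ (+-identityʳ 0#) (sym weight-split)
                            (+-mono-≤₂ (go cycle (shorter cycle-shorter)) (go rest (shorter rest-shorter)))
        where open Shortcut sc

    exchangeConstraint : Fin n × Fin d × Fin n → Maybe (Constraint n)
    exchangeConstraint (i , j , k) = if S i j then just (i , k , M i j - M k j) else nothing

    allTriples : List (Fin n × Fin d × Fin n)
    allTriples = cartesianProduct (allFin n) (cartesianProduct (allFin d) (allFin n))

    exchangeConstraints : List (Constraint n)
    exchangeConstraints = mapMaybe exchangeConstraint allTriples

    exchangeConstraint⁺ : ∀ {i j} k → S i j ≡ true → exchangeConstraint (i , j , k) ≡ just (i , k , M i j - M k j)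
    exchangeConstraint⁺ k sᵢⱼ rewrite sᵢⱼ = PE.refl

    exchangeConstraint⁻ : ∀ t {u v w} → exchangeConstraint t ≡ just (u , v , w) →
                          ∃ λ j → S u j ≡ true × w ≡ M u j - M v j
    exchangeConstraint⁻ (i , j , k) e with S i j in sᵢⱼ
    exchangeConstraint⁻ (i , j , k) PE.refl | true = j , sᵢⱼ , PE.refl

    walk⇒path : ∀ {u v} (q : Walk exchangeConstraints u v) → ∃ λ (p : Path u v) → weight q ≈ pathWeight p
    walk⇒path [] = [] , refl
    walk⇒path (c∈ ∷ q) with ∈-mapMaybe⁻ exchangeConstraint allTriples c∈ | walk⇒path q
    ... | t , _ , e | p , q≈p with exchangeConstraint⁻ t e
    ...   | j , s , PE.refl = step j _ s p , +-congˡ q≈p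

    permanentAttaining⇒satisfiable : PartialBijectionsAttain → Satisfiable F M S
    permanentAttaining⇒satisfiable attain = x , λ i j sᵢⱼ k → x-y≤z-w⇒x-z≤y-w (x-solves (constraint∈ k sᵢⱼ))
      where
      noNegativeCycle : NoNegativeCycle exchangeConstraints
      noNegativeCycle cycle =
        let p , cycle≈p = walk⇒path cycle in ≤-resp-≈ refl (sym cycle≈p) (cycle-nonnegative attain p)

      x : Fin n → Carrier
      x = proj₁ (noNegativeCycle⇒solvable exchangeConstraints noNegativeCycle)

      x-solves : Solves x exchangeConstraints
      x-solves = proj₂ (noNegativeCycle⇒solvable exchangeConstraints noNegativeCycle)

      constraint∈ : ∀ {i j} k → S i j ≡ true → (i , k , M i j - M k j) ∈ exchangeConstraints
      constraint∈ {i} {j} k sᵢⱼ = ∈-mapMaybe⁺ exchangeConstraint {xs = allTriples}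
        (∈-cartesianProduct⁺ (∈-allFin i) (∈-cartesianProduct⁺ (∈-allFin j) (∈-allFin k)))
        (exchangeConstraint⁺ k sᵢⱼ)

corollary5p3 : ∀ {c ℓ₁ ℓ₂} (R : OrderedField c ℓ₁ ℓ₂) {n d : ℕ}
                 (M : Mat R n d) (S : BMat n d) →
                 Satisfiable R M S ⇔
                 (∀ (σ : PMap d n) → IsPartialBijection σ → Contains S σ →
                    PermanentAttaining R M σ)
corollary5p3 R M S =
  mk⇔ (satisfiable⇒permanentAttaining R M S) (permanentAttaining⇒satisfiable R M S)
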